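{- Let $f:\mathbb{N}\to\mathbb{N}$ be an arbitrary non-decreasing function and let $d$ be a positive integer. There exist integers $k_0$ and $n_0$ such that if $T$ is a rooted tree of depth at most $d$ with at least $n_0$ leaves, then for some $k\le k_0$ there exists a vertex $v$ of $T$ that has at least $f(k)$ children, and the subtree of $T$ rooted at each child of $v$ has at most $k$ leaves. -}

module Defs where

open import Data.Nat using (ℕ; zero; suc; _+_; _≤_; _⊔_)
open import Data.List using (List; []; _∷_; length)
open import Data.List.Membership.Propositional using (_∈_)

data Tree : Set where
  node : List Tree → Tree

children : Tree → List Tree
children (node ts) = ts

mutual
  leaves : Tree → ℕ
  leaves (node []) = 1
  leaves (node (t ∷ ts)) = leavesList (t ∷ ts)

  leavesList : List Tree → ℕ
  leavesList [] = 0
  leavesList (t ∷ ts) = leaves t + leavesList ts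

mutual
  depth : Tree → ℕ
  depth (node []) = 0
  depth (node (t ∷ ts)) = suc (depthList (t ∷ ts))

  depthList : List Tree → ℕ
  depthList [] = 0
  depthList (t ∷ ts) = depth t ⊔ depthList ts

-- v ⊑ T : v is (the subtree rooted at) a vertex of T
data _⊑_ : Tree → Tree → Set where
  here  : ∀ {t} → t ⊑ t
  there : ∀ {v c t} → c ∈ children t → v ⊑ c → v ⊑ t

NonDecreasing : (ℕ → ℕ) → Set
NonDecreasing f = ∀ {m n} → m ≤ n → f m ≤ f n

-- By induction on the depth d we find K and N such that every tree of depth ≤ d
-- either has fewer than N leaves or contains a vertex with at least f k children,
-- each spanning at most k leaves, for some k ≤ K.  At a root of depth ≤ d + 1,
-- either some child already contains such a vertex, or every child has fewer
-- than N leaves; then the root itself is such a vertex for k = K ⊔ N, unless it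
-- has fewer than f (K ⊔ N) children, in which case it has fewer than f (K ⊔ N) * N
-- leaves.
module Submission where

open import Defs
open import Data.Nat using (ℕ; zero; suc; _*_; _<_; _≤_; _⊔_; z≤n; s≤s; _≤?_)
open import Data.Nat.Properties
open import Data.List using (List; []; _∷_; length)
open import Data.List.Relation.Unary.All as All using (All; []; _∷_)
open import Data.List.Relation.Unary.Any using (Any; here; there)
open import Data.List.Membership.Propositional using (_∈_; find)
open import Data.Product using (_×_; _,_; ∃-syntax)
open import Data.Sum as Sum using (_⊎_; inj₁; inj₂; [_,_]′)
open import Function using (id)
open import Data.Empty using (⊥-elim)
open import Relation.Nullary using (yes; no)

All⊎⇒All⊎Any : ∀ {A : Set} {P Q : A → Set} {xs : List A} →
  All (λ x → P x ⊎ Q x) xs → All P xs ⊎ Any Q xs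
All⊎⇒All⊎Any []              = inj₁ []
All⊎⇒All⊎Any (inj₁ p ∷ pqs) = Sum.map (p ∷_) there (All⊎⇒All⊎Any pqs)
All⊎⇒All⊎Any (inj₂ q ∷ _)   = inj₂ (here q)

depthList≤⇒All : ∀ {d} (ts : List Tree) → depthList ts ≤ d → All (λ t → depth t ≤ d) ts
depthList≤⇒All []       _ = []
depthList≤⇒All (t ∷ ts) p = m⊔n≤o⇒m≤o (depth t) _ p ∷ depthList≤⇒All ts (m⊔n≤o⇒n≤o (depth t) _ p)

leavesList≤length*bound : ∀ {N} (ts : List Tree) → All (λ t → leaves t ≤ N) ts →
  leavesList ts ≤ length ts * N
leavesList≤length*bound []       []       = z≤n
leavesList≤length*bound (t ∷ ts) (p ∷ ps) = +-mono-≤ p (leavesList≤length*bound ts ps)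

HasWideVertex : (ℕ → ℕ) → ℕ → Tree → Set
HasWideVertex f K T = ∃[ k ] (k ≤ K × ∃[ v ] (v ⊑ T × f k ≤ length (children v)
  × All (λ c → leaves c ≤ k) (children v)))

HasWideVertex-child : ∀ {f K K′ T c} → K ≤ K′ → c ∈ children T →
  HasWideVertex f K c → HasWideVertex f K′ T
HasWideVertex-child K≤K′ c∈T (k , k≤K , v , v⊑c , wide , small) =
  k , ≤-trans k≤K K≤K′ , v , there c∈T v⊑c , wide , small

wideVertex⊎fewLeaves : (f : ℕ → ℕ) (d : ℕ) → ∃[ K ] ∃[ N ]
  ((T : Tree) → depth T ≤ d → HasWideVertex f K T ⊎ leaves T < N)
wideVertex⊎fewLeaves f zero = 0 , 2 , λ where
  (node []) _ → inj₂ (s≤s (s≤s z≤n))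
  (node (_ ∷ _)) ()
wideVertex⊎fewLeaves f (suc d) with wideVertex⊎fewLeaves f d
... | K , N , ih = K ⊔ N , suc (suc (f (K ⊔ N) * N)) , step
  where
  step : (T : Tree) → depth T ≤ suc d →
    HasWideVertex f (K ⊔ N) T ⊎ leaves T < suc (suc (f (K ⊔ N) * N))
  step (node []) _ = inj₂ (s≤s (s≤s z≤n))
  step (node ts@(_ ∷ _)) (s≤s ts≤d)
    with All⊎⇒All⊎Any (All.map (λ {t} t≤d → Sum.swap (ih t t≤d)) (depthList≤⇒All ts ts≤d))
  ... | inj₂ someChildWide with find someChildWide
  ...   | c , c∈ts , cWide = inj₁ (HasWideVertex-child (m≤m⊔n K N) c∈ts cWide)
  step (node ts@(_ ∷ _)) _ | inj₁ childrenSmall with f (K ⊔ N) ≤? length ts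
  ...   | yes wide = inj₁ (K ⊔ N , ≤-refl , node ts , here , wide ,
                           All.map (λ p → ≤-trans (<⇒≤ p) (m≤n⊔m K N)) childrenSmall)
  ...   | no narrow = inj₂ (s≤s (m≤n⇒m≤1+n (begin
            leavesList ts         ≤⟨ leavesList≤length*bound ts (All.map <⇒≤ childrenSmall) ⟩
            length ts * N         ≤⟨ *-monoˡ-≤ N (<⇒≤ (≰⇒> narrow)) ⟩
            f (K ⊔ N) * N         ∎)))
    where open ≤-Reasoning

lemma3p8 : (f : ℕ → ℕ) → NonDecreasing f → (d : ℕ) → 1 ≤ d →
    ∃[ k₀ ] ∃[ n₀ ] ((T : Tree) → depth T ≤ d → n₀ ≤ leaves T →
    ∃[ k ] (k ≤ k₀ × ∃[ v ] (v ⊑ T × f k ≤ length (children v)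
    × All (λ c → leaves c ≤ k) (children v))))
lemma3p8 f _ d _ with wideVertex⊎fewLeaves f d
... | K , N , dichotomy = K , N , λ T T≤d N≤leaves →
  [ id , (λ few → ⊥-elim (<⇒≱ few N≤leaves)) ]′ (dichotomy T T≤d)
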